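{- Let $A$ be a finite alphabet with an involution without fixed points, $\Omega$ a set of idempotent variables, and $x\neq\overline x$ a reduced variable. Let $(U,V)$ be a strongly unbalanced typed equation with $U,V\in(A\cup\Omega\cup\{x,\overline x\})^*$, and let $n=\max\{|U|,|V|\}$. Let $k\in\mathbb Z$ and let $\sigma$ be a solution of $(U,V)$ such that $\sigma(x)=(\mathrm{pref}(p^k),p^k)$ for some nonempty cyclically reduced word $p\in A^*$ (where $p^k$ is the reduced word representing the $k$-th power in $\mathrm{FG}(A)$). Then $|k|\le 6n|p|$.
   Context: $\mathrm{FG}(C)=C^*/\{c\overline c=1\}$, identified with reduced words; a word $p$ is cyclically reduced if $pp$ is reduced; $\mathrm{pref}(w)$ is the set of prefixes of $w$. $\mathrm{FIM}(A)$ is the free inverse monoid (pairs $(P,g)$, $P$ a finite prefix-closed set of reduced words with $g\in P$, product $(P,g)(Q,h)=(P\cup gQ,gh)$); $\psi(a)=(\{1,a\},a)$. Idempotent variables satisfy $\overline Z=Z$. A solution of the typed equation $(U,V)$ is an involution-respecting assignment (values in $\mathrm{FIM}(A)$) with each $Z\in\Omega$ mapped to an idempotent $(P,1)$, $x$ mapped to $\psi$ of a reduced word, and both sides equal in $\mathrm{FIM}(A)$. Let $\pi_{A,\Gamma}$ erase the symbols of $\Omega$ and map into $\mathrm{FG}(A\cup\{x,\overline x\})$; $\delta_x(W)$ (resp. $\delta_{\overline x}(W)$) is the number of occurrences of $x$ minus that of $\overline x$ (resp. of $\overline x$ minus $x$) in $W$. $(U,V)$ is strongly unbalanced if $\pi_{A,\Gamma}(U)\neq\pi_{A,\Gamma}(V)$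 and at least one of: (SU1) $\delta_x(U)\neq\delta_x(V)$; (SU2) for all $z\in\Omega\cup\{1\}$ and all prefixes $V'z$ of $V$ there is a prefix $U'z$ of $U$ with $\delta_x(U')>\delta_x(V')$; (SU3) the same with $\delta_{\overline x}$ in place of $\delta_x$. -}

module Defs where

open import Data.Nat using (ℕ; zero; suc)
open import Data.Integer using (ℤ; +_; -[1+_]; -_; _>_)
import Data.Integer as ℤ
open import Data.Fin using (Fin)
import Data.Fin as Fin
open import Data.Bool using (Bool; true; false; not)
import Data.Bool as Bool
open import Data.Sum using (_⊎_; inj₁; inj₂)
open import Data.Sum.Properties using (≡-dec)
open import Data.Maybe using (Maybe; just; nothing)
open import Data.List using (List; []; _∷_; _++_; foldr; reverse; map; concat; replicate; inits)
open import Data.List.Membership.Propositional using (_∈_)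
open import Data.List.Relation.Unary.All using (All)
open import Data.Product using (Σ; ∃; _×_; _,_)
open import Data.Empty using (⊥)
open import Data.Unit using (⊤)
open import Relation.Nullary using (¬_; yes; no)
open import Relation.Binary.Definitions using (DecidableEquality)
open import Relation.Binary.PropositionalEquality using (_≡_; _≢_)
open import Function.Bundles using (_⇔_)

module Red {C : Set} (_≟_ : DecidableEquality C) (inv : C → C) where

  push : C → List C → List C
  push a [] = a ∷ []
  push a (b ∷ w) with b ≟ inv a
  ... | yes _ = w
  ... | no _  = a ∷ b ∷ w

  reduce : List C → List C
  reduce = foldr push []

  Reduced : List C → Set
  Reduced []            = ⊤
  Reduced (a ∷ [])      = ⊤
  Reduced (a ∷ b ∷ w)   = (b ≢ inv a) × Reduced (b ∷ w)

  CycReduced : List C → Set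
  CycReduced p = Reduced (p ++ p)

  invW : List C → List C
  invW w = reverse (map inv w)

  pow : List C → ℤ → List C
  pow p (+ n)      = reduce (concat (replicate n p))
  pow p -[1+ n ]   = reduce (concat (replicate (suc n) (invW p)))

data Sym (m : ℕ) (Ω : Set) : Set where
  lit  : Fin m → Sym m Ω
  var  : Ω → Sym m Ω
  X    : Sym m Ω
  Xbar : Sym m Ω

IsPrefix : {S : Set} → List S → List S → Set
IsPrefix u w = ∃ λ r → u ++ r ≡ w

module Equations {m : ℕ} (inv : Fin m → Fin m) (Ω : Set) where

  Word : Set
  Word = List (Fin m)

  open Red (Fin._≟_ {m}) inv public

  -- FG(A ∪ {x, x̄}) and the projection π_{A,Γ}
  invX : Fin m ⊎ Bool → Fin m ⊎ Bool
  invX (inj₁ a) = inj₁ (inv a)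
  invX (inj₂ b) = inj₂ (not b)   -- true = x, false = x̄

  module RX = Red (≡-dec (Fin._≟_ {m}) Bool._≟_) invX

  πsym : Sym m Ω → List (Fin m ⊎ Bool)
  πsym (lit a) = inj₁ a ∷ []
  πsym (var _) = []
  πsym X       = inj₂ true ∷ []
  πsym Xbar    = inj₂ false ∷ []

  π : List (Sym m Ω) → List (Fin m ⊎ Bool)
  π W = RX.reduce (concat (map πsym W))

  δx : List (Sym m Ω) → ℤ
  δx [] = + 0
  δx (X ∷ W)    = ℤ.suc (δx W)
  δx (Xbar ∷ W) = ℤ.pred (δx W)
  δx (_ ∷ W)    = δx W

  δxbar : List (Sym m Ω) → ℤ
  δxbar W = - δx W

  -- z ∈ Ω ∪ {1}, as a word of length ≤ 1
  zword : Maybe Ω → List (Sym m Ω)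
  zword nothing  = []
  zword (just Z) = var Z ∷ []

  SUcond : (List (Sym m Ω) → ℤ) → List (Sym m Ω) → List (Sym m Ω) → Set
  SUcond δ U V = ∀ (z : Maybe Ω) (V' : List (Sym m Ω)) → IsPrefix (V' ++ zword z) V →
                 ∃ λ U' → IsPrefix (U' ++ zword z) U × (δ U' > δ V')

  StronglyUnbalanced : List (Sym m Ω) → List (Sym m Ω) → Set
  StronglyUnbalanced U V =
    (π U ≢ π V) × ((δx U ≢ δx V) ⊎ SUcond δx U V ⊎ SUcond δxbar U V)

  -- The free inverse monoid FIM(A): pairs (P, g), P a finite set of
  -- reduced words (given as a list), g ∈ P.
  record FIM : Set where
    constructor ⟨_,_⟩
    field
      set : List Word
      elt : Word
  open FIM public

  _≈F_ : FIM → FIM → Set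
  s ≈F t = (elt s ≡ elt t) × (∀ w → (w ∈ set s) ⇔ (w ∈ set t))

  _·w_ : Word → Word → Word
  g ·w h = reduce (g ++ h)

  _∙_ : FIM → FIM → FIM
  ⟨ P , g ⟩ ∙ ⟨ Q , h ⟩ = ⟨ P ++ map (g ·w_) Q , g ·w h ⟩

  oneF : FIM
  oneF = ⟨ [] ∷ [] , [] ⟩

  _⁻¹ : FIM → FIM
  ⟨ P , g ⟩ ⁻¹ = ⟨ map (invW g ·w_) P , invW g ⟩

  ψw : Word → FIM
  ψw w = ⟨ inits w , w ⟩

  -- P is a finite prefix-closed set of reduced words containing 1
  -- (so that (P, 1) is an idempotent of FIM(A))
  IdemSet : List Word → Set
  IdemSet P = All Reduced P
            × (∀ {w} → w ∈ P → ∀ u v → u ++ v ≡ w → u ∈ P)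
            × ([] ∈ P)

  record Assignment : Set where
    field
      xval  : Word                 -- σ(x) = ψ(xval)
      xred  : Reduced xval
      zval  : Ω → List Word        -- σ(Z) = (zval Z, 1)
      zidem : ∀ Z → IdemSet (zval Z)

  module _ (σ : Assignment) where
    open Assignment σ

    -- involution-respecting: σ(a) = ψ(a), σ(x̄) = σ(x)⁻¹, σ(Z̄) = σ(Z)
    evalSym : Sym m Ω → FIM
    evalSym (lit a) = ψw (a ∷ [])
    evalSym (var Z) = ⟨ zval Z , [] ⟩
    evalSym X       = ψw xval
    evalSym Xbar    = (ψw xval) ⁻¹

    eval : List (Sym m Ω) → FIM
    eval = foldr (λ s t → evalSym s ∙ t) oneF

  IsSolution : Assignment → List (Sym m Ω) → List (Sym m Ω) → Set
  IsSolution σ U V = eval σ U ≈F eval σ V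

-- Write σ(x) = ψ(q^N) with q ∈ {p, p̄} and N = |k|. Brooks' counting function
-- h(w) = #(occurrences of q in w) − #(occurrences of q in w̄) changes by at most |q| − 1 under
-- concatenation, hence by at most 3(|q| − 1) under reduced products, and c = h(q^N) ≥ N because
-- q̄ never occurs in a power of the cyclically reduced word q. Reading a side of the equation, h
-- therefore moves by ±c at each x, x̄ and otherwise by at most 3|q| − 2 per symbol. Under SU1 both
-- sides reach the same group element with different x-balances; under SU2 (SU3, using −h) the
-- element of the common set maximising h is dominated by a prefix of V, and SU2 yields a prefix
-- of U of larger x-balance reaching an element higher by c. Either way c ≤ (|U| + |V|)(3|q| − 2).

module Submission where

open import Defs
open import Data.Nat as ℕ using (ℕ; zero; suc; _+_; _*_; _∸_; _≤_; z≤n; s≤s; _≤?_; _⊔_)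
import Data.Nat.Properties as ℕP
import Data.Nat.Tactic.RingSolver as ℕSolver
open import Data.Integer as ℤ using (ℤ; +_; -[1+_]; ∣_∣; +≤+; 0ℤ; 1ℤ) renaming (_+_ to _+ℤ_; _-_ to _-ℤ_; -_ to -ℤ_; _*_ to _*ℤ_; _≤_ to _≤ℤ_; _<_ to _<ℤ_)
import Data.Integer.Properties as ℤP
open import Data.Integer.Tactic.RingSolver using (solve-∀)
open import Data.Fin using (Fin)
import Data.Fin as Fin
open import Data.Maybe using (Maybe; just; nothing)
open import Data.List using (List; []; _∷_; [_]; _++_; _∷ʳ_; foldr; reverse; map; length; concat; replicate; inits; initLast; _∷ʳ′_)
open import Data.List.Properties
open import Data.List.Membership.Propositional using (_∈_)
open import Data.List.Membership.Propositional.Properties using (∈-map⁺; ∈-map⁻; ∈-++⁺ˡ; ∈-++⁺ʳ; ∈-++⁻)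
open import Data.List.Relation.Unary.Any using (here; there)
import Data.List.Relation.Unary.All as All
open import Data.Product using (∃; ∃₂; _×_; _,_; proj₁; proj₂)
open import Data.Sum using (_⊎_; inj₁; inj₂)
open import Data.Empty using (⊥-elim)
open import Data.Unit using (tt)
open import Relation.Nullary using (¬_; Dec; yes; no)
open import Relation.Binary.Definitions using (DecidableEquality)
open import Relation.Binary.PropositionalEquality hiding ([_])
open import Function using (_∘_; case_of_)
open import Function.Bundles using (_⇔_; Equivalence)
open import Data.List.Extrema ℤP.≤-totalOrder using (argmax; argmax-sel; f[xs]≤f[argmax])

power : {C : Set} → List C → ℕ → List C
power s j = concat (replicate j s)

module _ {C : Set} where

  ++-cancelʳ-length : (xs ys u v : List C) → xs ++ u ≡ ys ++ v → length xs ≡ length ys → xs ≡ ys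
  ++-cancelʳ-length []       []       u v _ _ = refl
  ++-cancelʳ-length (a ∷ xs) (b ∷ ys) u v e l with refl , e′ ← ∷-injective e =
    cong (a ∷_) (++-cancelʳ-length xs ys u v e′ (ℕP.suc-injective l))

  split-++ : (v xs u ys : List C) → xs ++ u ≡ v ++ ys → length v ≤ length xs →
             ∃ λ w → (xs ≡ v ++ w) × (w ++ u ≡ ys)
  split-++ []      xs       u ys e _ = xs , refl , e
  split-++ (a ∷ v) (b ∷ xs) u ys e (s≤s l) with refl , e′ ← ∷-injective e
    with w , xs≡ , ys≡ ← split-++ v xs u ys e′ l = w , cong (a ∷_) xs≡ , ys≡

  isPrefix-++ : (r x A B : List C) → r ++ x ≡ A ++ B → length r ≤ length A → IsPrefix r A
  isPrefix-++ r x A B e l = let w , A≡ , _ = split-++ r A B x (sym e) l in w , sym A≡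

  power-comm : (s : List C) (j : ℕ) → power s j ++ s ≡ s ++ power s j
  power-comm s zero    = sym (++-identityʳ s)
  power-comm s (suc j) = trans (++-assoc s (power s j) s) (cong (s ++_) (power-comm s j))

  ∈-inits-self : (w : List C) → w ∈ inits w
  ∈-inits-self []      = here refl
  ∈-inits-self (a ∷ w) = there (∈-map⁺ (a ∷_) (∈-inits-self w))

  ∈-inits⇒isPrefix : (w : List C) {t : List C} → t ∈ inits w → IsPrefix t w
  ∈-inits⇒isPrefix w       (here refl) = w , refl
  ∈-inits⇒isPrefix (a ∷ w) (there t∈) with t′ , t′∈ , refl ← ∈-map⁻ (a ∷_) t∈ =
    let r , e = ∈-inits⇒isPrefix w t′∈ in r , cong (a ∷_) e

  isPrefix-before : ∀ {W₁ W₂ W : List C} {s : C} → W₁ ++ s ∷ W₂ ≡ W → IsPrefix W₁ W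
  isPrefix-before {W₂ = W₂} {s = s} e = s ∷ W₂ , e

  isPrefix-through : ∀ {W₁ W₂ W : List C} {s : C} → W₁ ++ s ∷ W₂ ≡ W → IsPrefix (W₁ ++ [ s ]) W
  isPrefix-through {W₁} {W₂} {s = s} e = W₂ , trans (++-assoc W₁ [ s ] W₂) e

  maximum : (f : C → ℤ) (xs : List C) {x : C} → x ∈ xs → ∃ λ w → w ∈ xs × (∀ {u} → u ∈ xs → f u ≤ℤ f w)
  maximum f xs {x} x∈ = w , w∈ , λ u∈ → All.lookup (f[xs]≤f[argmax] x xs) u∈
    where
      w : C
      w = argmax f x xs
      w∈ : w ∈ xs
      w∈ with argmax-sel f x xs
      ... | inj₁ w≡x = subst (_∈ xs) (sym w≡x) x∈
      ... | inj₂ ∈xs = ∈xs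

  length-isPrefix : {t w : List C} → IsPrefix t w → length t ≤ length w
  length-isPrefix {t} (r , refl) = length-++-≤ˡ t

swap-minus : ∀ i j → i -ℤ j ≡ -ℤ (j -ℤ i)
swap-minus = solve-∀

∣i-j-k∣≤∣i∣+∣j∣+∣k∣ : ∀ i j k → ∣ i -ℤ j -ℤ k ∣ ≤ ∣ i ∣ + ∣ j ∣ + ∣ k ∣
∣i-j-k∣≤∣i∣+∣j∣+∣k∣ i j k =
  ℕP.≤-trans (ℤP.∣i-j∣≤∣i∣+∣j∣ (i -ℤ j) k) (ℕP.+-monoˡ-≤ ∣ k ∣ (ℤP.∣i-j∣≤∣i∣+∣j∣ i j))

∣i+j+k∣≤∣i∣+∣j∣+∣k∣ : ∀ i j k → ∣ i +ℤ j +ℤ k ∣ ≤ ∣ i ∣ + ∣ j ∣ + ∣ k ∣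
∣i+j+k∣≤∣i∣+∣j∣+∣k∣ i j k =
  ℕP.≤-trans (ℤP.∣i+j∣≤∣i∣+∣j∣ (i +ℤ j) k) (ℕP.+-monoˡ-≤ ∣ k ∣ (ℤP.∣i+j∣≤∣i∣+∣j∣ i j))

∣m-n∣≤ : ∀ {m n k} → m ≤ k → n ≤ k → ∣ + m -ℤ + n ∣ ≤ k
∣m-n∣≤ {m} {n} m≤k n≤k =
  ℕP.≤-trans (ℕP.≤-reflexive (cong ∣_∣ (ℤP.m-n≡m⊖n m n))) (ℕP.≤-trans (ℤP.∣m⊝n∣≤m⊔n m n) (ℕP.⊔-lub m≤k n≤k))

i≤∣i∣ : ∀ i → i ≤ℤ + ∣ i ∣
i≤∣i∣ (+ n)    = ℤP.≤-refl
i≤∣i∣ -[1+ n ] = ℤ.-≤+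

n≤∣i*n∣ : ∀ {i} n → i ≢ 0ℤ → n ≤ ∣ i *ℤ + n ∣
n≤∣i*n∣ {i} n i≢0 rewrite ℤP.abs-* i (+ n) with ∣ i ∣ in ∣i∣≡
... | zero    = ⊥-elim (i≢0 (ℤP.∣i∣≡0⇒i≡0 ∣i∣≡))
... | suc k   = ℕP.m≤m+n n (k * n)

≤-absorb : ∀ e k {y f b} → y ≤ℤ e +ℤ f +ℤ k → f ≤ℤ b → y ≤ℤ e +ℤ b +ℤ k
≤-absorb e k y≤ f≤b = ℤP.≤-trans y≤ (ℤP.+-monoˡ-≤ k (ℤP.+-monoʳ-≤ e f≤b))

i+j≤i+k⇒j≤k : ∀ i {j k} → i +ℤ j ≤ℤ i +ℤ k → j ≤ℤ k
i+j≤i+k⇒j≤k i {j} {k} h = begin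
  j                 ≡⟨ cancel i j ⟩
  -ℤ i +ℤ (i +ℤ j)  ≤⟨ ℤP.+-monoʳ-≤ (-ℤ i) h ⟩
  -ℤ i +ℤ (i +ℤ k)  ≡⟨ sym (cancel i k) ⟩
  k                 ∎
  where
    open ℤP.≤-Reasoning
    cancel : ∀ i j → j ≡ -ℤ i +ℤ (i +ℤ j)
    cancel = solve-∀

i<j⇒i*n+n≤j*n : ∀ {i j} n → i <ℤ j → i *ℤ + n +ℤ + n ≤ℤ j *ℤ + n
i<j⇒i*n+n≤j*n {i} n i<j =
  ℤP.≤-trans (ℤP.≤-reflexive (successor i (+ n))) (ℤP.*-monoʳ-≤-nonNeg (+ n) (ℤP.i<j⇒suc[i]≤j i<j))
  where
    successor : ∀ i n → i *ℤ n +ℤ n ≡ (1ℤ +ℤ i) *ℤ n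
    successor = solve-∀

i≡0⇒∣i∣≤1 : ∀ {i} → i ≡ 0ℤ → ∣ i ∣ ≤ 1
i≡0⇒∣i∣≤1 refl = z≤n

∣i-j∣≤k⇒i≤j+k : ∀ i j k → ∣ i -ℤ j ∣ ≤ k → i ≤ℤ j +ℤ + k
∣i-j∣≤k⇒i≤j+k i j k h = begin
  i              ≡⟨ i≡j+[i-j] i j ⟩
  j +ℤ (i -ℤ j)  ≤⟨ ℤP.+-monoʳ-≤ j (ℤP.≤-trans (i≤∣i∣ (i -ℤ j)) (+≤+ h)) ⟩
  j +ℤ + k       ∎
  where
    open ℤP.≤-Reasoning
    i≡j+[i-j] : ∀ i j → i ≡ j +ℤ (i -ℤ j)
    i≡j+[i-j] = solve-∀

∣i-j∣≤k⇒j≤i+k : ∀ i j k → ∣ i -ℤ j ∣ ≤ k → j ≤ℤ i +ℤ + k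
∣i-j∣≤k⇒j≤i+k i j k h = ∣i-j∣≤k⇒i≤j+k j i k (subst (_≤ k) (ℤP.∣i-j∣≡∣j-i∣ i j) h)

indicator : {P : Set} → Dec P → ℕ
indicator (yes _) = 1
indicator (no _)  = 0

indicator-mono : {P Q : Set} → (P → Q) → (p? : Dec P) (q? : Dec Q) → indicator p? ≤ indicator q?
indicator-mono _   (no _)  _       = z≤n
indicator-mono _   (yes _) (yes _) = s≤s z≤n
indicator-mono P⇒Q (yes p) (no ¬q) = ⊥-elim (¬q (P⇒Q p))

indicator≤1 : {P : Set} (p? : Dec P) → indicator p? ≤ 1
indicator≤1 (yes _) = s≤s z≤n
indicator≤1 (no _)  = z≤n

module Occurrences {C : Set} (_≟_ : DecidableEquality C) where

  isPrefix? : (r w : List C) → Dec (IsPrefix r w)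
  isPrefix? []      w       = yes (w , refl)
  isPrefix? (a ∷ r) []      = no λ ()
  isPrefix? (a ∷ r) (b ∷ w) with a ≟ b | isPrefix? r w
  ... | yes refl | yes (x , e) = yes (x , cong (a ∷_) e)
  ... | yes refl | no ¬pre     = no λ (x , e) → ¬pre (x , ∷-injectiveʳ e)
  ... | no a≢b   | _           = no λ (x , e) → a≢b (∷-injectiveˡ e)

  occ : List C → List C → ℕ
  occ r []      = 0
  occ r (a ∷ w) = indicator (isPrefix? r (a ∷ w)) + occ r w

  occ-++-≥ : ∀ r A B → occ r A + occ r B ≤ occ r (A ++ B)
  occ-++-≥ r []      B = ℕP.≤-refl
  occ-++-≥ r (a ∷ A) B = ℕP.≤-trans (ℕP.≤-reflexive (ℕP.+-assoc i (occ r A) (occ r B)))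
    (ℕP.+-mono-≤ (indicator-mono (λ (x , e) → x ++ B , trans (sym (++-assoc r x B)) (cong (_++ B) e)) (isPrefix? r (a ∷ A)) _)
                 (occ-++-≥ r A B))
    where
      i : ℕ
      i = indicator (isPrefix? r (a ∷ A))

  occ-++-≤-length : ∀ r A B → occ r (A ++ B) ≤ length A + occ r B
  occ-++-≤-length r []      B = ℕP.≤-refl
  occ-++-≤-length r (a ∷ A) B = ℕP.+-mono-≤ (indicator≤1 _) (occ-++-≤-length r A B)

  -- only the occurrences overlapping the junction, at most |r| - 1 of them, are new
  occ-++-≤ : ∀ r A B → occ r (A ++ B) ≤ (length r ∸ 1) + (occ r A + occ r B)
  occ-++-≤ r []      B = ℕP.m≤n+m (occ r B) (length r ∸ 1)
  occ-++-≤ r (a ∷ A) B with length r ≤? length (a ∷ A)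
  ... | yes r≤ = begin
      indicator (isPrefix? r (a ∷ A ++ B)) + occ r (A ++ B)
        ≤⟨ ℕP.+-mono-≤ (indicator-mono (λ (x , e) → isPrefix-++ r x (a ∷ A) B e r≤) _ (isPrefix? r (a ∷ A)))
                       (occ-++-≤ r A B) ⟩
      i + ((length r ∸ 1) + (occ r A + occ r B))
        ≡⟨ shuffle i (length r ∸ 1) (occ r A) (occ r B) ⟩
      (length r ∸ 1) + ((i + occ r A) + occ r B) ∎
    where
      open ℕP.≤-Reasoning
      i : ℕ
      i = indicator (isPrefix? r (a ∷ A))
      shuffle : ∀ i k a b → i + (k + (a + b)) ≡ k + ((i + a) + b)
      shuffle = ℕSolver.solve-∀
  ... | no r≰ = begin
      occ r (a ∷ A ++ B)                         ≤⟨ occ-++-≤-length r (a ∷ A) B ⟩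
      length (a ∷ A) + occ r B                   ≤⟨ ℕP.+-mono-≤ (ℕP.suc[m]≤n⇒m≤pred[n] (ℕP.≰⇒> r≰))
                                                                (ℕP.m≤n+m (occ r B) (occ r (a ∷ A))) ⟩
      (length r ∸ 1) + (occ r (a ∷ A) + occ r B) ∎
    where open ℕP.≤-Reasoning

  occ-≤-prefix : ∀ r {t w} → IsPrefix t w → occ r t ≤ occ r w
  occ-≤-prefix r {t} (x , refl) = ℕP.≤-trans (ℕP.m≤m+n (occ r t) (occ r x)) (occ-++-≥ r t x)

  occ-≤-suffix : ∀ r s t → occ r t ≤ occ r (s ++ t)
  occ-≤-suffix r s t = ℕP.≤-trans (ℕP.m≤n+m (occ r t) (occ r s)) (occ-++-≥ r s t)

  occ-self : ∀ r → r ≢ [] → 1 ≤ occ r r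
  occ-self []      r≢[] = ⊥-elim (r≢[] refl)
  occ-self (a ∷ r) _ with isPrefix? (a ∷ r) (a ∷ r)
  ... | yes _   = s≤s z≤n
  ... | no ¬pre = ⊥-elim (¬pre ([] , ++-identityʳ (a ∷ r)))

  occ-power : ∀ r → r ≢ [] → ∀ N → N ≤ occ r (power r N)
  occ-power r r≢[] zero    = z≤n
  occ-power r r≢[] (suc N) =
    ℕP.≤-trans (ℕP.+-mono-≤ (occ-self r r≢[]) (occ-power r r≢[] N)) (occ-++-≥ r r (power r N))

  occ-++-unstarted : ∀ r A Y → (∀ u v → u ++ v ≡ A → v ≢ [] → ¬ IsPrefix r (v ++ Y)) → occ r (A ++ Y) ≡ occ r Y
  occ-++-unstarted r []      Y _ = refl
  occ-++-unstarted r (a ∷ A) Y none with isPrefix? r (a ∷ A ++ Y)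
  ... | yes pre = ⊥-elim (none [] (a ∷ A) refl (λ ()) pre)
  ... | no _    = occ-++-unstarted r A Y (λ u v e → none (a ∷ u) v (cong (a ∷_) e))

  occ-++-excess : ∀ r A B → ∃ λ d → d ≤ length r ∸ 1 × occ r (A ++ B) ≡ occ r A + occ r B + d
  occ-++-excess r A B =
    occ r (A ++ B) ∸ (occ r A + occ r B) ,
    ℕP.m≤n+o⇒m∸n≤o (occ r (A ++ B)) (occ r A + occ r B)
      (ℕP.≤-trans (occ-++-≤ r A B) (ℕP.≤-reflexive (ℕP.+-comm (length r ∸ 1) _))) ,
    sym (ℕP.m+[n∸m]≡n (occ-++-≥ r A B))

module FreeReduction {m : ℕ} (inv : Fin m → Fin m)
                     (inv-involutive : ∀ a → inv (inv a) ≡ a) (inv-fixpointFree : ∀ a → inv a ≢ a) where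

  open Red (Fin._≟_ {m}) inv

  Word : Set
  Word = List (Fin m)

  reduced-tail : ∀ {a w} → Reduced (a ∷ w) → Reduced w
  reduced-tail {w = []}    _       = tt
  reduced-tail {w = _ ∷ _} (_ , r) = r

  reduced-++ˡ : ∀ x {y} → Reduced (x ++ y) → Reduced x
  reduced-++ˡ []          _        = tt
  reduced-++ˡ (a ∷ [])    _        = tt
  reduced-++ˡ (a ∷ b ∷ x) (ne , r) = ne , reduced-++ˡ (b ∷ x) r

  reduced-++ʳ : ∀ x {y} → Reduced (x ++ y) → Reduced y
  reduced-++ʳ []      r = r
  reduced-++ʳ (a ∷ x) r = reduced-++ʳ x (reduced-tail r)

  reduced-++-overlap : ∀ x {y z} → Reduced (x ++ y) → Reduced (y ++ z) → y ≢ [] → Reduced (x ++ y ++ z)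
  reduced-++-overlap []          _         r  _    = r
  reduced-++-overlap (a ∷ [])    {[]}    _ _  y≢[] = ⊥-elim (y≢[] refl)
  reduced-++-overlap (a ∷ [])    {b ∷ y} (ne , _) r _ = ne , r
  reduced-++-overlap (a ∷ b ∷ x) (ne , r₁) r₂ y≢[] = ne , reduced-++-overlap (b ∷ x) r₁ r₂ y≢[]

  reduced-push : ∀ a {w} → Reduced w → Reduced (push a w)
  reduced-push a {[]}    _ = tt
  reduced-push a {b ∷ w} r with b Fin.≟ inv a
  ... | yes _ = reduced-tail r
  ... | no ne = ne , r

  reduced-reduce : ∀ w → Reduced (reduce w)
  reduced-reduce []      = tt
  reduced-reduce (a ∷ w) = reduced-push a (reduced-reduce w)

  reduce-reduced : ∀ w → Reduced w → reduce w ≡ w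
  reduce-reduced []          _ = refl
  reduce-reduced (a ∷ [])    _ = refl
  reduce-reduced (a ∷ b ∷ w) (ne , r) rewrite reduce-reduced (b ∷ w) r with b Fin.≟ inv a
  ... | yes e = ⊥-elim (ne e)
  ... | no _  = refl

  invW-∷ : ∀ a w → invW (a ∷ w) ≡ invW w ∷ʳ inv a
  invW-∷ a w = unfold-reverse (inv a) (map inv w)

  invW-++ : ∀ x y → invW (x ++ y) ≡ invW y ++ invW x
  invW-++ x y = trans (cong reverse (map-++ inv x y)) (reverse-++ (map inv x) (map inv y))

  invW-involutive : ∀ w → invW (invW w) ≡ w
  invW-involutive w = begin
    reverse (map inv (reverse (map inv w)))  ≡⟨ cong reverse (reverse-map inv (map inv w)) ⟩
    reverse (reverse (map inv (map inv w)))  ≡⟨ reverse-involutive _ ⟩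
    map inv (map inv w)                      ≡⟨ sym (map-∘ w) ⟩
    map (inv ∘ inv) w                        ≡⟨ map-cong inv-involutive w ⟩
    map (λ a → a) w                          ≡⟨ map-id w ⟩
    w                                        ∎
    where open ≡-Reasoning

  length-invW : ∀ w → length (invW w) ≡ length w
  length-invW w = trans (length-reverse (map inv w)) (length-map inv w)

  reduced-invW : ∀ w → Reduced w → Reduced (invW w)
  reduced-invW []          _ = tt
  reduced-invW (a ∷ [])    _ = tt
  reduced-invW (a ∷ b ∷ w) (ne , r) = subst Reduced (sym split)
      (reduced-++-overlap (invW w) (subst Reduced (invW-∷ b w) (reduced-invW (b ∷ w) r)) junction (λ ()))
    where
      split : invW (a ∷ b ∷ w) ≡ invW w ++ [ inv b ] ++ [ inv a ]
      split = begin
        invW (a ∷ b ∷ w)                   ≡⟨ invW-∷ a (b ∷ w) ⟩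
        invW (b ∷ w) ∷ʳ inv a              ≡⟨ cong (_∷ʳ inv a) (invW-∷ b w) ⟩
        (invW w ∷ʳ inv b) ∷ʳ inv a         ≡⟨ ++-assoc (invW w) _ _ ⟩
        invW w ++ [ inv b ] ++ [ inv a ]   ∎
        where open ≡-Reasoning
      junction : Reduced ([ inv b ] ++ [ inv a ])
      junction = (λ e → ne (sym (trans e (inv-involutive b)))) , tt

  reduced-invW-++ : ∀ x y → Reduced (x ++ y) → Reduced (invW y ++ invW x)
  reduced-invW-++ x y r = subst Reduced (invW-++ x y) (reduced-invW (x ++ y) r)

  push-invW-cancel : ∀ w → foldr push w (invW w) ≡ []
  push-invW-cancel []      = refl
  push-invW-cancel (a ∷ w) rewrite invW-∷ a w | foldr-++ push (a ∷ w) (invW w) [ inv a ]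
    with a Fin.≟ inv (inv a)
  ... | yes _  = push-invW-cancel w
  ... | no a≢ = ⊥-elim (a≢ (sym (inv-involutive a)))

  reduce-invW-++ : ∀ w → Reduced w → reduce (invW w ++ w) ≡ []
  reduce-invW-++ w r = begin
    reduce (invW w ++ w)          ≡⟨ foldr-++ push [] (invW w) w ⟩
    foldr push (reduce w) (invW w) ≡⟨ cong (λ u → foldr push u (invW w)) (reduce-reduced w r) ⟩
    foldr push w (invW w)          ≡⟨ push-invW-cancel w ⟩
    []                             ∎
    where open ≡-Reasoning

  cancellation-split : ∀ g t → Reduced g →
    ∃₂ λ g′ r → ∃ λ t′ → (g ≡ g′ ++ r) × (t ≡ invW r ++ t′) × (foldr push t g ≡ g′ ++ t′)
  cancellation-split []      t _ = [] , [] , t , refl , refl , refl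
  cancellation-split (a ∷ g) t rg with cancellation-split g t (reduced-tail rg)
  ... | g′ , r , t′ , g≡ , t≡ , prod≡ rewrite prod≡ = extend g′ g≡ t′ t≡
    where
      extend : ∀ g′ → g ≡ g′ ++ r → ∀ t′ → t ≡ invW r ++ t′ →
        ∃₂ λ g″ r′ → ∃ λ t″ → (a ∷ g ≡ g″ ++ r′) × (t ≡ invW r′ ++ t″) × (push a (g′ ++ t′) ≡ g″ ++ t″)
      extend (b ∷ g′) g≡ t′ t≡ with b Fin.≟ inv a
      ... | yes b≡ = ⊥-elim (proj₁ (subst (λ u → Reduced (a ∷ u)) g≡ rg) b≡)
      ... | no _   = a ∷ b ∷ g′ , r , t′ , cong (a ∷_) g≡ , t≡ , refl
      extend [] g≡ []       t≡ = [ a ] , r , [] , cong (a ∷_) g≡ , t≡ , refl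
      extend [] g≡ (b ∷ t′) t≡ with b Fin.≟ inv a
      ... | no _   = [ a ] , r , b ∷ t′ , cong (a ∷_) g≡ , t≡ , refl
      ... | yes b≡ = [] , a ∷ r , t′ , cong (a ∷_) g≡ , t≡′ , refl
        where
          t≡′ : t ≡ invW (a ∷ r) ++ t′
          t≡′ = begin
            t                          ≡⟨ t≡ ⟩
            invW r ++ b ∷ t′           ≡⟨ cong (λ c → invW r ++ c ∷ t′) b≡ ⟩
            invW r ++ [ inv a ] ++ t′  ≡⟨ sym (++-assoc (invW r) _ t′) ⟩
            (invW r ∷ʳ inv a) ++ t′    ≡⟨ cong (_++ t′) (sym (invW-∷ a r)) ⟩
            invW (a ∷ r) ++ t′         ∎
            where open ≡-Reasoning

  invW-∷-∷ʳ : ∀ a mid c → invW (a ∷ mid ∷ʳ c) ≡ inv c ∷ invW mid ∷ʳ inv a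
  invW-∷-∷ʳ a mid c = trans (invW-∷ a (mid ∷ʳ c)) (cong (_∷ʳ inv a) (invW-++ mid [ c ]))

  private
    invW-fixed⇒[]-bounded : ∀ n v → length v ≤ n → Reduced v → invW v ≡ v → v ≡ []
    invW-fixed⇒[]-bounded _ [] _ _ _ = refl
    invW-fixed⇒[]-bounded n (a ∷ w) _ _ e with initLast w
    ... | [] = ⊥-elim (inv-fixpointFree a (∷-injectiveˡ e))
    invW-fixed⇒[]-bounded (suc n) (a ∷ _) (s≤s l) r e | mid ∷ʳ′ c
      with inv-c≡a , e′ ← ∷-injective (trans (sym (invW-∷-∷ʳ a mid c)) e)
      with invW-mid≡mid , _ ← ∷ʳ-injective (invW mid) mid e′
      with refl ← invW-fixed⇒[]-bounded n mid (ℕP.≤-trans (length-++-≤ˡ mid) l)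
                    (reduced-++ˡ mid (reduced-tail r)) invW-mid≡mid
      = ⊥-elim (proj₁ r (trans (sym (inv-involutive c)) (cong inv inv-c≡a)))

  invW-fixed⇒[] : ∀ v → Reduced v → invW v ≡ v → v ≡ []
  invW-fixed⇒[] v = invW-fixed⇒[]-bounded (length v) v ℕP.≤-refl

  reduced-power : ∀ s → Reduced (s ++ s) → s ≢ [] → ∀ j → Reduced (power s j)
  reduced-power s rss s≢[] zero    = tt
  reduced-power s rss s≢[] (suc j) = reduced-s++power j
    where
      reduced-s++power : ∀ j → Reduced (s ++ power s j)
      reduced-s++power zero    = subst Reduced (sym (++-identityʳ s)) (reduced-++ˡ s rss)
      reduced-s++power (suc j) = reduced-++-overlap s rss (reduced-s++power j) s≢[]

  invW-power : ∀ s j → invW (power s j) ≡ power (invW s) j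
  invW-power s zero    = refl
  invW-power s (suc j) = begin
    invW (s ++ power s j)             ≡⟨ invW-++ s (power s j) ⟩
    invW (power s j) ++ invW s        ≡⟨ cong (_++ invW s) (invW-power s j) ⟩
    power (invW s) j ++ invW s        ≡⟨ power-comm (invW s) j ⟩
    invW s ++ power (invW s) j        ∎
    where open ≡-Reasoning

  invW-≢[] : ∀ w → w ≢ [] → invW w ≢ []
  invW-≢[] []      w≢[] _  = w≢[] refl
  invW-≢[] (a ∷ w) _    e = case trans (sym (length-invW (a ∷ w))) (cong length e) of λ ()

  base : Word → ℤ → Word
  base p (+ _)    = p
  base p -[1+ _ ] = invW p

  length-base : ∀ p k → length (base p k) ≡ length p
  length-base p (+ _)    = refl
  length-base p -[1+ _ ] = length-invW p

  base-≢[] : ∀ p k → p ≢ [] → base p k ≢ []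
  base-≢[] p (+ _)    p≢[] = p≢[]
  base-≢[] p -[1+ _ ] p≢[] = invW-≢[] p p≢[]

  base-cycReduced : ∀ p k → CycReduced p → CycReduced (base p k)
  base-cycReduced p (+ _)    cyc = cyc
  base-cycReduced p -[1+ _ ] cyc = reduced-invW-++ p p cyc

  pow≡power-base : ∀ p k → CycReduced p → p ≢ [] → pow p k ≡ power (base p k) ∣ k ∣
  pow≡power-base p k cyc p≢[] = pow-unfold k (reduce-reduced (power (base p k) ∣ k ∣)
    (reduced-power (base p k) (base-cycReduced p k cyc) (base-≢[] p k p≢[]) ∣ k ∣))
    where
      pow-unfold : ∀ k → reduce (power (base p k) ∣ k ∣) ≡ power (base p k) ∣ k ∣ → pow p k ≡ power (base p k) ∣ k ∣
      pow-unfold (+ _)    e = e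
      pow-unfold -[1+ _ ] e = e

  open Occurrences (Fin._≟_ {m})

  -- If s̄ occurred at a cut s = u v (v ≠ []), the letters of s̄ would match v and then the
  -- next copy of s, forcing v̄ = v, which no nonempty reduced word satisfies.
  occ-invW-power : ∀ s → Reduced s → s ≢ [] → ∀ N → occ (invW s) (power s N) ≡ 0
  occ-invW-power s rs s≢[] zero    = refl
  occ-invW-power s rs s≢[] (suc N) =
    trans (occ-++-unstarted (invW s) s (power s N) (no-cut-occurrence (power s N) (s , power-comm s N)))
          (occ-invW-power s rs s≢[] N)
    where
      no-cut-occurrence : ∀ Y → IsPrefix Y (s ++ Y) → ∀ u v → u ++ v ≡ s → v ≢ [] → ¬ IsPrefix (invW s) (v ++ Y)
      no-cut-occurrence Y (z , Yz≡sY) u v uv≡s v≢[] (x , e) = v≢[] (invW-fixed⇒[] v rv invW-v≡v)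
        where
          rv : Reduced v
          rv = reduced-++ʳ u (subst Reduced (sym uv≡s) rs)
          length-invW-s : length (invW s) ≡ length u + length v
          length-invW-s = trans (length-invW s) (trans (cong length (sym uv≡s)) (length-++ u))
          split : ∃ λ w → (invW s ≡ v ++ w) × (w ++ x ≡ Y)
          split = split-++ v (invW s) x Y e
                    (subst (length v ≤_) (sym length-invW-s) (ℕP.m≤n+m (length v) (length u)))
          w : Word
          w = proj₁ split
          invW-s≡vw : invW s ≡ v ++ w
          invW-s≡vw = proj₁ (proj₂ split)
          length-w : length w ≡ length u
          length-w = ℕP.+-cancelˡ-≡ (length v) (length w) (length u)
            (trans (sym (length-++ v)) (trans (cong length (sym invW-s≡vw))
              (trans length-invW-s (ℕP.+-comm (length u) (length v)))))
          w≡u : w ≡ u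
          w≡u = ++-cancelʳ-length w u (x ++ z) (v ++ Y) (begin
            w ++ x ++ z      ≡⟨ sym (++-assoc w x z) ⟩
            (w ++ x) ++ z    ≡⟨ cong (_++ z) (proj₂ (proj₂ split)) ⟩
            Y ++ z           ≡⟨ Yz≡sY ⟩
            s ++ Y           ≡⟨ cong (_++ Y) (sym uv≡s) ⟩
            (u ++ v) ++ Y    ≡⟨ ++-assoc u v Y ⟩
            u ++ v ++ Y      ∎) length-w
            where open ≡-Reasoning
          invW-v≡v : invW v ≡ v
          invW-v≡v = ++-cancelʳ-length (invW v) v (invW u) u
            (trans (sym (invW-++ u v)) (trans (cong invW uv≡s) (trans invW-s≡vw (cong (v ++_) w≡u)))) (length-invW v)

  reduce-++-reduced : ∀ g {t} → Reduced t → reduce (g ++ t) ≡ foldr push t g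
  reduce-++-reduced g {t} rt = trans (foldr-++ push [] g t) (cong (λ u → foldr push u g) (reduce-reduced t rt))

  -- Split g = g′r and t = r̄t′ so that the reduced product is g′t′.
  defect-from-concatenation : (f : Word → ℤ) (K : ℕ) →
    (∀ A B → ∣ f (A ++ B) -ℤ (f A +ℤ f B) ∣ ≤ K) → (∀ w → f (invW w) ≡ -ℤ f w) →
    ∀ g t → Reduced g → Reduced t → ∣ f (reduce (g ++ t)) -ℤ (f g +ℤ f t) ∣ ≤ 3 * K
  defect-from-concatenation f K f-++ f-invW g t rg rt
    with g′ , r , t′ , refl , refl , product≡ ← cancellation-split g t rg = begin
      ∣ f (reduce ((g′ ++ r) ++ invW r ++ t′)) -ℤ (f (g′ ++ r) +ℤ f (invW r ++ t′)) ∣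
        ≡⟨ cong (λ w → ∣ f w -ℤ (f (g′ ++ r) +ℤ f (invW r ++ t′)) ∣)
                (trans (reduce-++-reduced (g′ ++ r) rt) product≡) ⟩
      ∣ f (g′ ++ t′) -ℤ (f (g′ ++ r) +ℤ f (invW r ++ t′)) ∣
        ≡⟨ cong ∣_∣ (three-defects (f (g′ ++ t′)) (f g′) (f t′) (f r) (f (g′ ++ r)) (f (invW r ++ t′))) ⟩
      ∣ D₁ -ℤ D₂ -ℤ D₃ ∣         ≤⟨ ∣i-j-k∣≤∣i∣+∣j∣+∣k∣ D₁ D₂ D₃ ⟩
      ∣ D₁ ∣ + ∣ D₂ ∣ + ∣ D₃ ∣   ≤⟨ ℕP.+-mono-≤ (ℕP.+-mono-≤ (f-++ g′ t′) (f-++ g′ r)) inverse-defect ⟩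
      K + K + K                  ≡⟨ thrice K ⟩
      3 * K                      ∎
    where
      open ℕP.≤-Reasoning
      D₁ D₂ D₃ : ℤ
      D₁ = f (g′ ++ t′) -ℤ (f g′ +ℤ f t′)
      D₂ = f (g′ ++ r) -ℤ (f g′ +ℤ f r)
      D₃ = f (invW r ++ t′) -ℤ (-ℤ f r +ℤ f t′)
      three-defects : ∀ F a b ρ G T →
        F -ℤ (G +ℤ T) ≡ (F -ℤ (a +ℤ b)) -ℤ (G -ℤ (a +ℤ ρ)) -ℤ (T -ℤ (-ℤ ρ +ℤ b))
      three-defects = solve-∀
      thrice : ∀ K → K + K + K ≡ 3 * K
      thrice = ℕSolver.solve-∀
      inverse-defect : ∣ D₃ ∣ ≤ K
      inverse-defect = subst (λ z → ∣ f (invW r ++ t′) -ℤ (z +ℤ f t′) ∣ ≤ K) (f-invW r) (f-++ (invW r) t′)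

  record Quasimorphism (E : ℕ) : Set where
    field
      φ        : Word → ℤ
      φ-[]     : φ [] ≡ 0ℤ
      φ-invW   : ∀ w → φ (invW w) ≡ -ℤ φ w
      φ-letter : ∀ a → ∣ φ [ a ] ∣ ≤ 1
      φ-defect : ∀ g t → Reduced g → Reduced t → ∣ φ (reduce (g ++ t)) -ℤ (φ g +ℤ φ t) ∣ ≤ E

  negate : ∀ {E} → Quasimorphism E → Quasimorphism E
  negate {E} q = record
    { φ        = λ w → -ℤ φ w
    ; φ-[]     = cong -ℤ_ φ-[]
    ; φ-invW   = λ w → cong -ℤ_ (φ-invW w)
    ; φ-letter = λ a → subst (_≤ 1) (sym (ℤP.∣-i∣≡∣i∣ (φ [ a ]))) (φ-letter a)
    ; φ-defect = λ g t rg rt → subst (_≤ E) (negated g t) (φ-defect g t rg rt)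
    }
    where
      open Quasimorphism q
      negated-defect : ∀ a b c → -ℤ a -ℤ (-ℤ b +ℤ -ℤ c) ≡ -ℤ (a -ℤ (b +ℤ c))
      negated-defect = solve-∀
      negated : ∀ g t → ∣ φ (reduce (g ++ t)) -ℤ (φ g +ℤ φ t) ∣ ≡ ∣ -ℤ φ (reduce (g ++ t)) -ℤ (-ℤ φ g +ℤ -ℤ φ t) ∣
      negated g t = trans (sym (ℤP.∣-i∣≡∣i∣ (φ (reduce (g ++ t)) -ℤ (φ g +ℤ φ t))))
                          (cong ∣_∣ (sym (negated-defect (φ (reduce (g ++ t))) (φ g) (φ t))))

module Brooks {m : ℕ} (inv : Fin m → Fin m)
              (inv-involutive : ∀ a → inv (inv a) ≡ a) (inv-fixpointFree : ∀ a → inv a ≢ a)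
              (p : List (Fin m)) where

  open Red (Fin._≟_ {m}) inv
  open FreeReduction inv inv-involutive inv-fixpointFree
  open Occurrences (Fin._≟_ {m})

  h : Word → ℤ
  h w = + occ p w -ℤ + occ p (invW w)

  h-++ : ∀ A B → ∣ h (A ++ B) -ℤ (h A +ℤ h B) ∣ ≤ length p ∸ 1
  h-++ A B with d , d≤ , occ≡ ← occ-++-excess p A B | d′ , d′≤ , occ′≡ ← occ-++-excess p (invW B) (invW A) =
    subst (λ z → ∣ z ∣ ≤ length p ∸ 1) (sym defect≡) (∣m-n∣≤ d≤ d′≤)
    where
      open ≡-Reasoning
      excess-identity : ∀ a b d a′ b′ d′ →
        + (a + b + d) -ℤ + (b′ + a′ + d′) -ℤ ((+ a -ℤ + a′) +ℤ (+ b -ℤ + b′)) ≡ + d -ℤ + d′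
      excess-identity a b d a′ b′ d′
        rewrite ℤP.pos-+ (a + b) d | ℤP.pos-+ a b | ℤP.pos-+ (b′ + a′) d′ | ℤP.pos-+ b′ a′ =
        identity (+ a) (+ b) (+ d) (+ a′) (+ b′) (+ d′)
        where
          identity : ∀ a b d a′ b′ d′ → a +ℤ b +ℤ d -ℤ (b′ +ℤ a′ +ℤ d′) -ℤ ((a -ℤ a′) +ℤ (b -ℤ b′)) ≡ d -ℤ d′
          identity = solve-∀
      defect≡ : h (A ++ B) -ℤ (h A +ℤ h B) ≡ + d -ℤ + d′
      defect≡ = begin
        h (A ++ B) -ℤ (h A +ℤ h B)
          ≡⟨ cong₂ (λ c c′ → + c -ℤ + c′ -ℤ (h A +ℤ h B)) occ≡ (trans (cong (occ p) (invW-++ A B)) occ′≡) ⟩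
        + (occ p A + occ p B + d) -ℤ + (occ p (invW B) + occ p (invW A) + d′) -ℤ (h A +ℤ h B)
          ≡⟨ excess-identity (occ p A) (occ p B) d (occ p (invW A)) (occ p (invW B)) d′ ⟩
        + d -ℤ + d′ ∎

  h-invW : ∀ w → h (invW w) ≡ -ℤ h w
  h-invW w rewrite invW-involutive w = swap-minus (+ occ p (invW w)) (+ occ p w)

  h-letter : ∀ a → ∣ h [ a ] ∣ ≤ 1
  h-letter a = ∣m-n∣≤ (occ-++-≤-length p [ a ] []) (occ-++-≤-length p [ inv a ] [])

  brooks : Quasimorphism (3 * (length p ∸ 1))
  brooks = record
    { φ        = h
    ; φ-[]     = refl
    ; φ-invW   = h-invW
    ; φ-letter = h-letter
    ; φ-defect = defect-from-concatenation h (length p ∸ 1) h-++ h-invW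
    }

module Evaluation {m : ℕ} (inv : Fin m → Fin m)
                  (inv-involutive : ∀ a → inv (inv a) ≡ a) (inv-fixpointFree : ∀ a → inv a ≢ a)
                  (Ω : Set) (σ : Equations.Assignment inv Ω) where

  open Equations inv Ω hiding (Word)
  open FreeReduction inv inv-involutive inv-fixpointFree
  open Assignment σ

  act : List (Sym m Ω) → Word → Word
  act W t = foldr (λ s u → elt (evalSym σ s) ·w u) t W

  elt-eval : ∀ W → elt (eval σ W) ≡ act W []
  elt-eval []      = refl
  elt-eval (s ∷ W) = cong (elt (evalSym σ s) ·w_) (elt-eval W)

  act-++ : ∀ A B t → act (A ++ B) t ≡ act A (act B t)
  act-++ A B t = foldr-++ _ t A B

  reduced-elt : ∀ s → Reduced (elt (evalSym σ s))
  reduced-elt (lit a) = tt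
  reduced-elt (var Z) = tt
  reduced-elt X       = xred
  reduced-elt Xbar    = reduced-invW xval xred

  reduced-act : ∀ W {t} → Reduced t → Reduced (act W t)
  reduced-act []      rt = rt
  reduced-act (s ∷ W) {t} rt = reduced-reduce (elt (evalSym σ s) ++ act W t)

  reduced-∈-set : ∀ s {t} → t ∈ set (evalSym σ s) → Reduced t
  reduced-∈-set (lit a) (here refl)         = tt
  reduced-∈-set (lit a) (there (here refl)) = tt
  reduced-∈-set (var Z) t∈                  = All.lookup (proj₁ (zidem Z)) t∈
  reduced-∈-set X       t∈ = let r , e = ∈-inits⇒isPrefix xval t∈ in reduced-++ˡ _ (subst Reduced (sym e) xred)
  reduced-∈-set Xbar    t∈ with t₀ , _ , refl ← ∈-map⁻ (invW xval ·w_) t∈ = reduced-reduce (invW xval ++ t₀)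

  []∈-set : ∀ s → [] ∈ set (evalSym σ s)
  []∈-set (lit a) = here refl
  []∈-set (var Z) = proj₂ (proj₂ (zidem Z))
  []∈-set X       = here refl
  []∈-set Xbar    = subst (_∈ set (evalSym σ Xbar)) (reduce-invW-++ xval xred) (∈-map⁺ _ (∈-inits-self xval))

  ∈-set-eval⁻ : ∀ W {w} → w ∈ set (eval σ W) →
    (∃₂ λ W₁ s → ∃₂ λ W₂ t → (W₁ ++ s ∷ W₂ ≡ W) × (t ∈ set (evalSym σ s)) × (w ≡ act W₁ t)) ⊎ (w ≡ act W [])
  ∈-set-eval⁻ []      (here refl) = inj₂ refl
  ∈-set-eval⁻ (s ∷ W) w∈ with ∈-++⁻ (set (evalSym σ s)) w∈
  ... | inj₁ w∈s = inj₁ ([] , s , W , _ , refl , w∈s , refl)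
  ... | inj₂ w∈rest with w′ , w′∈ , refl ← ∈-map⁻ (elt (evalSym σ s) ·w_) w∈rest with ∈-set-eval⁻ W w′∈
  ...   | inj₁ (W₁ , s′ , W₂ , t , W≡ , t∈ , refl) = inj₁ (s ∷ W₁ , s′ , W₂ , t , cong (s ∷_) W≡ , t∈ , refl)
  ...   | inj₂ refl = inj₂ refl

  act-∈-set-eval : ∀ W₁ s W₂ {t} → t ∈ set (evalSym σ s) → act W₁ t ∈ set (eval σ (W₁ ++ s ∷ W₂))
  act-∈-set-eval []       s W₂ t∈ = ∈-++⁺ˡ t∈
  act-∈-set-eval (s′ ∷ W₁) s W₂ t∈ = ∈-++⁺ʳ (set (evalSym σ s′)) (∈-map⁺ _ (act-∈-set-eval W₁ s W₂ t∈))

  act[]-∈-set-eval : ∀ W → act W [] ∈ set (eval σ W)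
  act[]-∈-set-eval []      = here refl
  act[]-∈-set-eval (s ∷ W) = ∈-++⁺ʳ (set (evalSym σ s)) (∈-map⁺ _ (act[]-∈-set-eval W))

  -- z ∈ Ω ∪ {1} read as the idempotent (zset z, 1)
  zset : Maybe Ω → List Word
  zset nothing  = [ [] ]
  zset (just Z) = zval Z

  reduced-∈-zset : ∀ z {t} → t ∈ zset z → Reduced t
  reduced-∈-zset nothing  (here refl) = tt
  reduced-∈-zset (just Z) t∈          = All.lookup (proj₁ (zidem Z)) t∈

  act-∈-set-eval-prefix : ∀ W z W′ {t} → IsPrefix (W′ ++ zword z) W → t ∈ zset z → act W′ t ∈ set (eval σ W)
  act-∈-set-eval-prefix W nothing W′ ([] , e) (here refl) =
    subst (λ V → act W′ [] ∈ set (eval σ V)) (trans (sym (++-identityʳ W′)) (trans (sym (++-identityʳ _)) e))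
          (act[]-∈-set-eval W′)
  act-∈-set-eval-prefix W nothing W′ (s ∷ r , e) (here refl) =
    subst (λ V → act W′ [] ∈ set (eval σ V)) (trans (cong (_++ s ∷ r) (sym (++-identityʳ W′))) e)
          (act-∈-set-eval W′ s r ([]∈-set s))
  act-∈-set-eval-prefix W (just Z) W′ (r , e) t∈ =
    subst (λ V → act W′ _ ∈ set (eval σ V)) (trans (sym (++-assoc W′ [ var Z ] r)) e)
          (act-∈-set-eval W′ (var Z) r t∈)

  δx-∷ : ∀ s W → δx (s ∷ W) ≡ δx [ s ] +ℤ δx W
  δx-∷ (lit _) W = sym (ℤP.+-identityˡ (δx W))
  δx-∷ (var _) W = sym (ℤP.+-identityˡ (δx W))
  δx-∷ X       W = refl
  δx-∷ Xbar    W = refl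

  δx-++ : ∀ A B → δx (A ++ B) ≡ δx A +ℤ δx B
  δx-++ []      B = sym (ℤP.+-identityˡ (δx B))
  δx-++ (s ∷ A) B = begin
    δx (s ∷ A ++ B)                ≡⟨ δx-∷ s (A ++ B) ⟩
    δx [ s ] +ℤ δx (A ++ B)        ≡⟨ cong (δx [ s ] +ℤ_) (δx-++ A B) ⟩
    δx [ s ] +ℤ (δx A +ℤ δx B)     ≡⟨ sym (ℤP.+-assoc (δx [ s ]) (δx A) (δx B)) ⟩
    δx [ s ] +ℤ δx A +ℤ δx B       ≡⟨ cong (_+ℤ δx B) (sym (δx-∷ s A)) ⟩
    δx (s ∷ A) +ℤ δx B             ∎
    where open ≡-Reasoning

  module Bound {E : ℕ} (q : Quasimorphism E) (dX : ℤ) (c : ℕ) (φ-x : Quasimorphism.φ q xval ≡ dX *ℤ + c) where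

    open Quasimorphism q

    weight : List (Sym m Ω) → ℤ
    weight W = dX *ℤ δx W

    expected : List (Sym m Ω) → ℤ
    expected W = weight W *ℤ + c

    slack : List (Sym m Ω) → ℕ
    slack W = length W * suc E

    expected-++ : ∀ A B → expected (A ++ B) ≡ expected A +ℤ expected B
    expected-++ A B = trans (cong (λ δ → dX *ℤ δ *ℤ + c) (δx-++ A B)) (scaled-sum dX (δx A) (δx B) (+ c))
      where
        scaled-sum : ∀ d a b c → d *ℤ (a +ℤ b) *ℤ c ≡ d *ℤ a *ℤ c +ℤ d *ℤ b *ℤ c
        scaled-sum = solve-∀

    expected-++-X : ∀ W → expected W +ℤ dX *ℤ + c ≡ expected (W ++ [ X ]) +ℤ 0ℤ
    expected-++-X W = trans (step (expected W) dX (+ c)) (cong (_+ℤ 0ℤ) (sym (expected-++ W [ X ])))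
      where
        step : ∀ e d c → e +ℤ d *ℤ c ≡ e +ℤ d *ℤ + 1 *ℤ c +ℤ 0ℤ
        step = solve-∀

    expected-++-Xbar : ∀ W → expected (W ++ [ Xbar ]) +ℤ dX *ℤ + c ≡ expected W +ℤ 0ℤ
    expected-++-Xbar W = trans (cong (_+ℤ dX *ℤ + c) (expected-++ W [ Xbar ])) (step (expected W) dX (+ c))
      where
        step : ∀ e d c → e +ℤ d *ℤ -[1+ 0 ] *ℤ c +ℤ d *ℤ c ≡ e +ℤ 0ℤ
        step = solve-∀

    symbol-drift : ∀ s → ∣ φ (elt (evalSym σ s)) -ℤ expected [ s ] ∣ ≤ 1
    symbol-drift (lit a) = subst (_≤ 1) (cong ∣_∣ (sym (minus-zero (φ [ a ]) dX (+ c)))) (φ-letter a)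
      where
        minus-zero : ∀ i d c → i -ℤ d *ℤ 0ℤ *ℤ c ≡ i
        minus-zero = solve-∀
    symbol-drift (var Z) rewrite φ-[] = i≡0⇒∣i∣≤1 (vanishes dX (+ c))
      where
        vanishes : ∀ d c → 0ℤ -ℤ d *ℤ 0ℤ *ℤ c ≡ 0ℤ
        vanishes = solve-∀
    symbol-drift X rewrite φ-x = i≡0⇒∣i∣≤1 (vanishes dX (+ c))
      where
        vanishes : ∀ d c → d *ℤ c -ℤ d *ℤ + 1 *ℤ c ≡ 0ℤ
        vanishes = solve-∀
    symbol-drift Xbar rewrite φ-invW xval | φ-x = i≡0⇒∣i∣≤1 (vanishes dX (+ c))
      where
        vanishes : ∀ d c → -ℤ (d *ℤ c) -ℤ d *ℤ -[1+ 0 ] *ℤ c ≡ 0ℤ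
        vanishes = solve-∀

    drift : ∀ W {t} → Reduced t → ∣ φ (act W t) -ℤ (expected W +ℤ φ t) ∣ ≤ slack W
    drift [] {t} _ = ℕP.≤-reflexive (cong ∣_∣ (vanishes (φ t) dX (+ c)))
      where
        vanishes : ∀ f d c → f -ℤ (d *ℤ 0ℤ *ℤ c +ℤ f) ≡ 0ℤ
        vanishes = solve-∀
    drift (s ∷ W) {t} rt = begin
      ∣ φ (g ·w u) -ℤ (expected ([ s ] ++ W) +ℤ φ t) ∣
        ≡⟨ cong (λ e → ∣ φ (g ·w u) -ℤ (e +ℤ φ t) ∣) (expected-++ [ s ] W) ⟩
      ∣ φ (g ·w u) -ℤ (expected [ s ] +ℤ expected W +ℤ φ t) ∣
        ≡⟨ cong ∣_∣ (drift-split (φ (g ·w u)) (φ g) (φ u) (expected [ s ]) (expected W) (φ t)) ⟩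
      ∣ D₀ +ℤ D₁ +ℤ D₂ ∣
        ≤⟨ ∣i+j+k∣≤∣i∣+∣j∣+∣k∣ D₀ D₁ D₂ ⟩
      ∣ D₀ ∣ + ∣ D₁ ∣ + ∣ D₂ ∣
        ≤⟨ ℕP.+-mono-≤ (ℕP.+-mono-≤ (symbol-drift s) (φ-defect g u (reduced-elt s) (reduced-act W rt))) (drift W rt) ⟩
      slack (s ∷ W) ∎
      where
        open ℕP.≤-Reasoning
        g u : Word
        g = elt (evalSym σ s)
        u = act W t
        D₀ D₁ D₂ : ℤ
        D₀ = φ g -ℤ expected [ s ]
        D₁ = φ (g ·w u) -ℤ (φ g +ℤ φ u)
        D₂ = φ u -ℤ (expected W +ℤ φ t)
        drift-split : ∀ F g u eₛ e φt → F -ℤ (eₛ +ℤ e +ℤ φt) ≡ (g -ℤ eₛ) +ℤ (F -ℤ (g +ℤ u)) +ℤ (u -ℤ (e +ℤ φt))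
        drift-split = solve-∀

    drift-upper : ∀ W {t} → Reduced t → φ (act W t) ≤ℤ expected W +ℤ φ t +ℤ + slack W
    drift-upper W {t} rt = ∣i-j∣≤k⇒i≤j+k (φ (act W t)) _ (slack W) (drift W rt)

    drift-lower : ∀ W {t} → Reduced t → expected W +ℤ φ t ≤ℤ φ (act W t) +ℤ + slack W
    drift-lower W {t} rt = ∣i-j∣≤k⇒j≤i+k (φ (act W t)) _ (slack W) (drift W rt)

    slack-++ : ∀ U V → slack U + slack V ≡ (length U + length V) * suc E
    slack-++ U V = sym (ℕP.*-distribʳ-+ (suc E) (length U) (length V))

    bound-from-elt : ∀ U V → act U [] ≡ act V [] → weight U ≢ weight V → c ≤ (length U + length V) * suc E
    bound-from-elt U V act≡ weight≢ = begin
      c                                    ≤⟨ n≤∣i*n∣ c (λ d≡0 → weight≢ (ℤP.i-j≡0⇒i≡j _ _ d≡0)) ⟩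
      ∣ (weight U -ℤ weight V) *ℤ + c ∣   ≡⟨ cong ∣_∣ (difference-of-drifts x (weight U) (weight V) (+ c) (φ [])) ⟩
      ∣ Dᵥ -ℤ Dᵤ ∣                        ≤⟨ ℤP.∣i-j∣≤∣i∣+∣j∣ Dᵥ Dᵤ ⟩
      ∣ Dᵥ ∣ + ∣ Dᵤ ∣                      ≤⟨ ℕP.+-mono-≤ (subst (λ w → ∣ φ w -ℤ _ ∣ ≤ slack V) (sym act≡) (drift V tt))
                                                          (drift U tt) ⟩
      slack V + slack U                    ≡⟨ ℕP.+-comm (slack V) (slack U) ⟩
      slack U + slack V                    ≡⟨ slack-++ U V ⟩
      (length U + length V) * suc E        ∎
      where
        open ℕP.≤-Reasoning
        x Dᵤ Dᵥ : ℤ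
        x = φ (act U [])
        Dᵤ = x -ℤ (expected U +ℤ φ [])
        Dᵥ = x -ℤ (expected V +ℤ φ [])
        difference-of-drifts : ∀ x a b c f₀ → (a -ℤ b) *ℤ c ≡ (x -ℤ (b *ℤ c +ℤ f₀)) -ℤ (x -ℤ (a *ℤ c +ℤ f₀))
        difference-of-drifts = solve-∀

    PrefixesBelow : Set
    PrefixesBelow = ∀ t → t ∈ inits xval → φ t ≤ℤ 0ℤ ⊎ φ t ≤ℤ dX *ℤ + c

    Dominated : List (Sym m Ω) → ℤ → Set
    Dominated W y = ∃₂ λ z W′ → ∃ λ t →
      IsPrefix (W′ ++ zword z) W × t ∈ zset z × y ≤ℤ expected W′ +ℤ φ t +ℤ + slack W

    dominated-at-prefix : ∀ W {y} W′ {e} → IsPrefix W′ W → e ≡ expected W′ +ℤ 0ℤ →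
                          y ≤ℤ e +ℤ + slack W → Dominated W y
    dominated-at-prefix W {y} W′ (r , W′r≡W) refl y≤ =
      nothing , W′ , [] , (r , trans (cong (_++ r) (++-identityʳ W′)) W′r≡W) , here refl ,
      subst (λ f → y ≤ℤ expected W′ +ℤ f +ℤ + slack W) (sym φ-[]) y≤

    φ[]≤0 : φ [] ≤ℤ 0ℤ
    φ[]≤0 = ℤP.≤-reflexive φ-[]

    drift-upper-prefix : ∀ {W W′ t} → IsPrefix W′ W → Reduced t → φ (act W′ t) ≤ℤ expected W′ +ℤ φ t +ℤ + slack W
    drift-upper-prefix {W′ = W′} {t} pre rt =
      ℤP.≤-trans (drift-upper W′ rt) (ℤP.+-monoʳ-≤ (expected W′ +ℤ φ t) (+≤+ (ℕP.*-monoˡ-≤ (suc E) (length-isPrefix pre))))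

    upper-envelope : PrefixesBelow → ∀ W {w} → w ∈ set (eval σ W) → Dominated W (φ w)
    upper-envelope below W w∈ with ∈-set-eval⁻ W w∈
    ... | inj₂ refl =
      dominated-at-prefix W W ([] , ++-identityʳ W) refl (≤-absorb (expected W) (+ slack W) (drift-upper W tt) φ[]≤0)
    ... | inj₁ (W₁ , lit a , W₂ , _ , W≡ , here refl , refl) =
      dominated-at-prefix W W₁ (isPrefix-before W≡) refl (≤-absorb (expected W₁) (+ slack W) (drift-upper-prefix (isPrefix-before W≡) tt) φ[]≤0)
    ... | inj₁ (W₁ , lit a , W₂ , _ , W≡ , there (here refl) , refl) =
      subst (Dominated W ∘ φ) (act-++ W₁ [ lit a ] [])
        (dominated-at-prefix W (W₁ ++ [ lit a ]) (isPrefix-through W≡) refl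
          (≤-absorb (expected (W₁ ++ [ lit a ])) (+ slack W) (drift-upper-prefix (isPrefix-through W≡) tt) φ[]≤0))
    ... | inj₁ (W₁ , var Z , W₂ , t , W≡ , t∈ , refl) =
      just Z , W₁ , t , isPrefix-through W≡ , t∈ , drift-upper-prefix (isPrefix-before W≡) (reduced-∈-zset (just Z) t∈)
    ... | inj₁ (W₁ , X , W₂ , t , W≡ , t∈ , refl) with below t t∈
    ...   | inj₁ φt≤0 =
      dominated-at-prefix W W₁ (isPrefix-before W≡) refl
        (≤-absorb (expected W₁) (+ slack W) (drift-upper-prefix (isPrefix-before W≡) (reduced-∈-set X t∈)) φt≤0)
    ...   | inj₂ φt≤dc =
      dominated-at-prefix W (W₁ ++ [ X ]) (isPrefix-through W≡)
        (expected-++-X W₁)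
        (≤-absorb (expected W₁) (+ slack W) (drift-upper-prefix (isPrefix-before W≡) (reduced-∈-set X t∈)) φt≤dc)
    upper-envelope below W w∈
        | inj₁ (W₁ , Xbar , W₂ , _ , W≡ , t∈ , refl) with t₀ , t₀∈ , refl ← ∈-map⁻ (invW xval ·w_) t∈
      = subst (Dominated W ∘ φ) (act-++ W₁ [ Xbar ] t₀) (past-Xbar (below t₀ t₀∈))
      where
        bound : φ (act (W₁ ++ [ Xbar ]) t₀) ≤ℤ expected (W₁ ++ [ Xbar ]) +ℤ φ t₀ +ℤ + slack W
        bound = drift-upper-prefix (isPrefix-through W≡) (reduced-∈-set X t₀∈)
        past-Xbar : φ t₀ ≤ℤ 0ℤ ⊎ φ t₀ ≤ℤ dX *ℤ + c → Dominated W (φ (act (W₁ ++ [ Xbar ]) t₀))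
        past-Xbar (inj₁ φt₀≤0)  = dominated-at-prefix W (W₁ ++ [ Xbar ]) (isPrefix-through W≡) refl (≤-absorb (expected (W₁ ++ [ Xbar ])) (+ slack W) bound φt₀≤0)
        past-Xbar (inj₂ φt₀≤dc) = dominated-at-prefix W W₁ (isPrefix-before W≡)
          (expected-++-Xbar W₁)
          (≤-absorb (expected (W₁ ++ [ Xbar ])) (+ slack W) bound φt₀≤dc)

    lower-envelope : ∀ W z W′ {t} → IsPrefix (W′ ++ zword z) W → t ∈ zset z →
      act W′ t ∈ set (eval σ W) × expected W′ +ℤ φ t ≤ℤ φ (act W′ t) +ℤ + slack W
    lower-envelope W z W′ {t} pre t∈ =
      act-∈-set-eval-prefix W z W′ pre t∈ ,
      ℤP.≤-trans (drift-lower W′ (reduced-∈-zset z t∈))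
                 (ℤP.+-monoʳ-≤ (φ (act W′ t)) (+≤+ (ℕP.*-monoˡ-≤ (suc E) (ℕP.≤-trans (length-++-≤ˡ W′) (length-isPrefix pre)))))

    bound-from-sets : PrefixesBelow → ∀ U V → (∀ w → (w ∈ set (eval σ U)) ⇔ (w ∈ set (eval σ V))) →
                      SUcond weight U V → c ≤ (length U + length V) * suc E
    bound-from-sets below U V same-sets su
      with w* , w*∈ , maximal ← maximum φ (set (eval σ V)) (act[]-∈-set-eval V)
      with z , V′ , t , preV , t∈ , w*≤ ← upper-envelope below V w*∈
      with U′ , preU , weight< ← su z V′ preV
      with u∈ , u≥ ← lower-envelope U z U′ preU t∈ =
      subst (c ≤_) (slack-++ U V) (ℤP.drop‿+≤+ (i+j≤i+k⇒j≤k (expected V′ +ℤ φ t) (begin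
        expected V′ +ℤ φ t +ℤ + c            ≡⟨ rotate (expected V′) (φ t) (+ c) ⟩
        expected V′ +ℤ + c +ℤ φ t            ≤⟨ ℤP.+-monoˡ-≤ (φ t) (i<j⇒i*n+n≤j*n c weight<) ⟩
        expected U′ +ℤ φ t                   ≤⟨ u≥ ⟩
        φ (act U′ t) +ℤ + slack U            ≤⟨ ℤP.+-monoˡ-≤ (+ slack U) (maximal (Equivalence.to (same-sets _) u∈)) ⟩
        φ w* +ℤ + slack U                    ≤⟨ ℤP.+-monoˡ-≤ (+ slack U) w*≤ ⟩
        expected V′ +ℤ φ t +ℤ + slack V +ℤ + slack U
                                             ≡⟨ collect (expected V′ +ℤ φ t) (slack V) (slack U) ⟩
        expected V′ +ℤ φ t +ℤ + (slack U + slack V) ∎)))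
      where
        open ℤP.≤-Reasoning
        rotate : ∀ a b c → a +ℤ b +ℤ c ≡ a +ℤ c +ℤ b
        rotate = solve-∀
        collect : ∀ a m n → a +ℤ + m +ℤ + n ≡ a +ℤ + (n + m)
        collect a m n rewrite ℤP.pos-+ n m = identity a (+ m) (+ n)
          where
            identity : ∀ a m n → a +ℤ m +ℤ n ≡ a +ℤ (n +ℤ m)
            identity = solve-∀

module _ {m : ℕ} (inv : Fin m → Fin m)
         (inv-involutive : ∀ a → inv (inv a) ≡ a) (inv-fixpointFree : ∀ a → inv a ≢ a)
         (Ω : Set) (σ : Equations.Assignment inv Ω) where

  open Equations inv Ω hiding (Word)
  open FreeReduction inv inv-involutive inv-fixpointFree
  open Occurrences (Fin._≟_ {m})
  open Evaluation inv inv-involutive inv-fixpointFree Ω σ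
  open Assignment σ

  SUcond-cong : ∀ {δ δ′ U V} → (∀ W → δ W ≡ δ′ W) → SUcond δ U V → SUcond δ′ U V
  SUcond-cong δ≡δ′ su z V′ pre = let U′ , preU , gt = su z V′ pre in U′ , preU , subst₂ ℤ._>_ (δ≡δ′ U′) (δ≡δ′ V′) gt

  module _ (q : Word) (q≢[] : q ≢ []) (cyc : CycReduced q) (N : ℕ) (x≡qᴺ : xval ≡ power q N) where

    open Brooks inv inv-involutive inv-fixpointFree q

    N≤occ-x : N ≤ occ q xval
    N≤occ-x = subst (λ w → N ≤ occ q w) (sym x≡qᴺ) (occ-power q q≢[] N)

    occ-invW-x : occ q (invW xval) ≡ 0
    occ-invW-x = begin
      occ q (invW xval)                         ≡⟨ cong (occ q) (trans (cong invW x≡qᴺ) (invW-power q N)) ⟩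
      occ q (power (invW q) N)                  ≡⟨ cong (λ r → occ r (power (invW q) N)) (sym (invW-involutive q)) ⟩
      occ (invW (invW q)) (power (invW q) N)    ≡⟨ occ-invW-power (invW q) (reduced-invW q (reduced-++ˡ q cyc))
                                                                  (invW-≢[] q q≢[]) N ⟩
      0                                         ∎
      where open ≡-Reasoning

    h-x : h xval ≡ 1ℤ *ℤ + occ q xval
    h-x = trans (cong (λ n → + occ q xval -ℤ + n) occ-invW-x)
                (trans (ℤP.+-identityʳ (+ occ q xval)) (sym (ℤP.*-identityˡ (+ occ q xval))))

    module Up   = Bound brooks 1ℤ (occ q xval) h-x
    module Down = Bound (negate brooks) (-ℤ 1ℤ) (occ q xval)
                    (trans (cong -ℤ_ (trans h-x (ℤP.*-identityˡ (+ occ q xval)))) (sym (ℤP.-1*i≡-i (+ occ q xval))))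

    up-below : Up.PrefixesBelow
    up-below t t∈ = inj₂ (begin
      h t                  ≤⟨ ℤP.i-j≤i (+ occ q t) (+ occ q (invW t)) ⟩
      + occ q t            ≤⟨ +≤+ (occ-≤-prefix q (∈-inits⇒isPrefix xval t∈)) ⟩
      + occ q xval         ≡⟨ sym (ℤP.*-identityˡ (+ occ q xval)) ⟩
      1ℤ *ℤ + occ q xval   ∎)
      where open ℤP.≤-Reasoning

    down-below : Down.PrefixesBelow
    down-below t t∈ with r , tr≡x ← ∈-inits⇒isPrefix xval t∈ = inj₁ (begin
      -ℤ h t                          ≡⟨ sym (swap-minus (+ occ q (invW t)) (+ occ q t)) ⟩
      + occ q (invW t) -ℤ + occ q t   ≤⟨ ℤP.i-j≤i (+ occ q (invW t)) (+ occ q t) ⟩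
      + occ q (invW t)                ≤⟨ +≤+ (occ-≤-suffix q (invW r) (invW t)) ⟩
      + occ q (invW r ++ invW t)      ≡⟨ cong (λ w → + occ q w) (trans (sym (invW-++ t r)) (cong invW tr≡x)) ⟩
      + occ q (invW xval)             ≡⟨ cong +_ occ-invW-x ⟩
      0ℤ                              ∎)
      where open ℤP.≤-Reasoning

    exponent-bound : ∀ U V → StronglyUnbalanced U V → IsSolution σ U V →
                     N ≤ (length U + length V) * suc (3 * (length q ∸ 1))
    exponent-bound U V (_ , unbalanced) (elt≡ , same-sets) = ℕP.≤-trans N≤occ-x (occ-bound unbalanced)
      where
        occ-bound : (δx U ≢ δx V) ⊎ SUcond δx U V ⊎ SUcond δxbar U V →
                    occ q xval ≤ (length U + length V) * suc (3 * (length q ∸ 1))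
        occ-bound (inj₁ δ≢) = Up.bound-from-elt U V (trans (sym (elt-eval U)) (trans elt≡ (elt-eval V)))
          (λ e → δ≢ (trans (sym (ℤP.*-identityˡ (δx U))) (trans e (ℤP.*-identityˡ (δx V)))))
        occ-bound (inj₂ (inj₁ su)) = Up.bound-from-sets up-below U V same-sets
          (SUcond-cong (λ W → sym (ℤP.*-identityˡ (δx W))) su)
        occ-bound (inj₂ (inj₂ su)) = Down.bound-from-sets down-below U V same-sets
          (SUcond-cong (λ W → sym (ℤP.-1*i≡-i (δx W))) su)

exponent-arithmetic : ∀ u v L N → N ≤ (u + v) * suc (3 * L) → N ≤ 6 * (u ⊔ v) * suc L
exponent-arithmetic u v L N N≤ = ℕP.≤-trans N≤ (begin
  (u + v) * suc (3 * L)        ≤⟨ ℕP.*-mono-≤ (ℕP.+-mono-≤ (ℕP.m≤m⊔n u v) (ℕP.m≤n⊔m u v))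
                                               (ℕP.≤-trans (ℕP.m≤m+n (suc (3 * L)) 2) (ℕP.≤-reflexive (three-suc L))) ⟩
  (n + n) * (3 * suc L)        ≡⟨ six n (suc L) ⟩
  6 * n * suc L                ∎)
  where
    open ℕP.≤-Reasoning
    n : ℕ
    n = u ⊔ v
    three-suc : ∀ L → suc (3 * L) + 2 ≡ 3 * suc L
    three-suc = ℕSolver.solve-∀
    six : ∀ n ℓ → (n + n) * (3 * ℓ) ≡ 6 * n * ℓ
    six = ℕSolver.solve-∀

lemma6p9 : ∀ {m : ℕ} (inv : Fin m → Fin m)
           → (∀ a → inv (inv a) ≡ a)
           → (∀ a → inv a ≢ a)
           → (Ω : Set)
           → (U V : List (Sym m Ω))
           → Equations.StronglyUnbalanced inv Ω U V
           → (k : ℤ) (p : List (Fin m))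
           → p ≢ []
           → Equations.CycReduced inv Ω p
           → (σ : Equations.Assignment inv Ω)
           → Equations.IsSolution inv Ω σ U V
           → Equations._≈F_ inv Ω (Equations.evalSym inv Ω σ X)
               (Equations.⟨_,_⟩ (inits (Equations.pow inv Ω p k)) (Equations.pow inv Ω p k))
           → ∣ k ∣ ≤ 6 * (length U ⊔ length V) * length p

lemma6p9 _ _ _ _ _ _ _ _ [] p≢[] _ _ _ _ = ⊥-elim (p≢[] refl)
lemma6p9 inv inv-involutive inv-fixpointFree Ω U V unbalanced k p@(_ ∷ p′) p≢[] cyc σ solution (x≡pᵏ , _) =
  exponent-arithmetic (length U) (length V) (length p′) ∣ k ∣
    (subst (λ ℓ → ∣ k ∣ ≤ (length U + length V) * suc (3 * (ℓ ∸ 1))) (length-base p k)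
      (exponent-bound inv inv-involutive inv-fixpointFree Ω σ
        (base p k) (base-≢[] p k p≢[]) (base-cycReduced p k cyc) ∣ k ∣ (trans x≡pᵏ (pow≡power-base p k cyc p≢[]))
        U V unbalanced solution))
  where open FreeReduction inv inv-involutive inv-fixpointFree
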